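{- Let $G$ be a finite simple graph with at least one edge which is topologically $t$-chromatic, and let $\mathbb{F}$ be any field. Then \[\overline{\xi}_l(G,\mathbb{F}) \geq \lceil t/2 \rceil + 1.\]
   Context: All graphs are finite, simple and undirected; $N(v)$ denotes the set of neighbors of a vertex $v$. For $x,y\in\mathbb{F}^s$ let $\langle x,y\rangle=\sum_{i=1}^s x_iy_i$ (over $\mathbb{C}$ the Hermitian form $\sum_i x_i\overline{y_i}$ may be used instead). An orthogonal representation of $G=(V,E)$ over $\mathbb{F}$ is an assignment of a vector $u_v\in\mathbb{F}^s$ (for some $s$) to each $v\in V$ such that $\langle u_v,u_v\rangle\neq 0$ for every $v$ and $\langle u_v,u_{v'}\rangle=0$ whenever $v,v'$ are adjacent. Its locality is $\max_{v\in V}\dim \mathrm{span}\{u_{v'} : v'\in\{v\}\cup N(v)\}$. The local orthogonality dimension $\overline{\xi}_l(G,\mathbb{F})$ is the smallest possible locality of an orthogonal representation of $G$ over $\mathbb{F}$. Topological notions: A $\mathbb{Z}_2$-poset is a poset $P$ together with an order-preserving involution $\nu:P\to P$ without fixed points; a $\mathbb{Z}_2$-map between $\mathbb{Z}_2$-posets is an order-preserving map commuting with the involutions. For an integer $s\ge 0$, $Q_s$ is the $\mathbb{Z}_2$-poset on the elements $\{\pm1,\pm2,\dots,\pm(s+1)\}$ with $x<y$ iff $|x|<|y|$, and involution $x\mapsto -x$. The cross-index $\mathrm{Xind}(P)$ of a $\mathbb{Z}_2$-poset $P$ is the minimum $s$ such that there is a $\mathbb{Z}_2$-map $P\to Q_s$.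 For a graph $G=(V,E)$, $\mathrm{Hom}(K_2,G)$ is the $\mathbb{Z}_2$-poset of all ordered pairs $(A,B)$ of nonempty subsets of $V$ such that every vertex of $A$ is adjacent to every vertex of $B$, ordered by $(A,B)\le(A',B')$ iff $A\subseteq A'$ and $B\subseteq B'$, with involution $(A,B)\mapsto(B,A)$. The graph $G$ is called topologically $t$-chromatic if $t\le \mathrm{Xind}(\mathrm{Hom}(K_2,G))+2$. -}

module Defs where

open import Level using (Level; _⊔_; suc)
open import Algebra.Bundles using (CommutativeRing)
open import Data.Nat as ℕ using (ℕ; _<_)
open import Data.Fin using (Fin; toℕ)
import Data.Fin as Fin
open import Data.Fin.Subset using (Subset; _∈_; _⊆_; Nonempty)
open import Data.Bool using (Bool; not)
open import Data.Product using (Σ; ∃; _×_; _,_)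
open import Data.Sum using (_⊎_)
open import Relation.Nullary using (¬_)
open import Relation.Binary.PropositionalEquality using (_≡_)

record Field (c ℓ : Level) : Set (Level.suc (c ⊔ ℓ)) where
  field
    commutativeRing : CommutativeRing c ℓ
  open CommutativeRing commutativeRing public
  field
    1≉0     : ¬ (1# ≈ 0#)
    inverse : ∀ x → ¬ (x ≈ 0#) → Σ Carrier λ y → (x * y) ≈ 1#

record Graph : Set₁ where
  field
    n        : ℕ
    Adj      : Fin n → Fin n → Set
    Adj-sym  : ∀ {x y} → Adj x y → Adj y x
    Adj-irr  : ∀ {x} → ¬ Adj x x

HasEdge : Graph → Set
HasEdge G = ∃ λ x → ∃ λ y → Graph.Adj G x y

InClosedNbhd : (G : Graph) → Fin (Graph.n G) → Fin (Graph.n G) → Set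
InClosedNbhd G v w = (w ≡ v) ⊎ Graph.Adj G v w

module LinAlg {c ℓ : Level} (F : Field c ℓ) where
  open Field F

  sumF : ∀ {k : ℕ} → (Fin k → Carrier) → Carrier
  sumF {ℕ.zero}  f = 0#
  sumF {ℕ.suc k} f = f Fin.zero + sumF (λ i → f (Fin.suc i))

  ⟪_,_⟫ : ∀ {s} → (Fin s → Carrier) → (Fin s → Carrier) → Carrier
  ⟪ x , y ⟫ = sumF (λ i → x i * y i)

  InSpan : ∀ {s d} → (Fin d → Fin s → Carrier) → (Fin s → Carrier) → Set (c ⊔ ℓ)
  InSpan {s} {d} w x = Σ (Fin d → Carrier) λ a →
    ∀ (i : Fin s) → x i ≈ sumF (λ j → a j * w j i)

  DimSpan≤ : ∀ {s} {I : Set} → (I → Set) → (I → Fin s → Carrier) → ℕ → Set (c ⊔ ℓ)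
  DimSpan≤ {s} {I} P x d = Σ (Fin d → Fin s → Carrier) λ w →
    ∀ (k : I) → P k → InSpan w (x k)

  record OrthRep (G : Graph) (s : ℕ) : Set (c ⊔ ℓ) where
    field
      u        : Fin (Graph.n G) → Fin s → Carrier
      nondeg   : ∀ v → ¬ (⟪ u v , u v ⟫ ≈ 0#)
      orth     : ∀ v w → Graph.Adj G v w → ⟪ u v , u w ⟫ ≈ 0#

  Locality≤ : ∀ {G s} → OrthRep G s → ℕ → Set (c ⊔ ℓ)
  Locality≤ {G} ρ d = ∀ v → DimSpan≤ (InClosedNbhd G v) (OrthRep.u ρ) d

  LocOrthDim≥ : Graph → ℕ → Set (c ⊔ ℓ)
  LocOrthDim≥ G k = ∀ (s : ℕ) (ρ : OrthRep G s) (d : ℕ) → Locality≤ ρ d → k ℕ.≤ d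

-- Q_s : elements ±1,…,±(s+1) encoded as (i , b) with |x| = i+1, sign b.
Q : ℕ → Set
Q s = Fin (ℕ.suc s) × Bool

_≤Q_ : ∀ {s} → Q s → Q s → Set
(i , b) ≤Q (j , c) = ((i ≡ j) × (b ≡ c)) ⊎ (toℕ i < toℕ j)

negQ : ∀ {s} → Q s → Q s
negQ (i , b) = (i , not b)

record HomK2 (G : Graph) : Set where
  field
    A B   : Subset (Graph.n G)
    A-ne  : Nonempty A
    B-ne  : Nonempty B
    compl : ∀ {a b} → a ∈ A → b ∈ B → Graph.Adj G a b

_≤H_ : ∀ {G} → HomK2 G → HomK2 G → Set
p ≤H q = (HomK2.A p ⊆ HomK2.A q) × (HomK2.B p ⊆ HomK2.B q)

swapH : ∀ {G} → HomK2 G → HomK2 G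
swapH {G} p = record
  { A = HomK2.B p ; B = HomK2.A p ; A-ne = HomK2.B-ne p ; B-ne = HomK2.A-ne p
  ; compl = λ a∈ b∈ → Graph.Adj-sym G (HomK2.compl p b∈ a∈) }

record Z2Map (G : Graph) (s : ℕ) : Set where
  field
    f        : HomK2 G → Q s
    monotone : ∀ {p q} → p ≤H q → f p ≤Q f q
    equivar  : ∀ p → f (swapH p) ≡ negQ (f p)

IsXindHom : Graph → ℕ → Set
IsXindHom G s = Z2Map G s × (∀ s' → Z2Map G s' → s ℕ.≤ s')

TopChromatic : Graph → ℕ → Set
TopChromatic G t = ∃ λ s → IsXindHom G s × (t ℕ.≤ s ℕ.+ 2)

{-# OPTIONS --safe #-}
-- Fix an orthogonal representation u of locality at most d and let r(A) be the dimension of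
-- span {u a : a ∈ A}. If all of A is adjacent to a vertex z, then u z is orthogonal to span A but
-- not to itself, so span A and u z together lie in the (at most d-dimensional) span of the closed
-- neighbourhood of z, whence r(A) ≤ d - 1; so 1 ≤ r(A), r(B) ≤ d - 1 for every (A , B) in
-- Hom(K₂,G). Send (A , B) to level (r(A) - 1) + (r(B) - 1) ≤ 2d - 4, with positive sign iff the
-- first vertex whose vector lies in span A ∪ span B lies in span A; the two spans are orthogonal,
-- so no vertex lies in both and swapping A and B flips the sign. Enlarging A or B either raises a
-- rank or keeps both spans, hence the sign, unchanged, so this is a Z₂-map into Q_{2d-4}. Thus
-- t - 2 ≤ Xind ≤ 2d - 4, i.e. ⌈t/2⌉ + 1 ≤ d, where the edge of G guarantees d ≥ 2.
-- Dimensions are compared through greedy bases and the Steinitz exchange lemma. The classical case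
-- distinctions (whether a coefficient vanishes, whether a vector lies in a span) are made in the
-- double-negation monad, which is harmless since every conclusion drawn from them is a decidable
-- inequality of natural numbers.
module Submission where

open import Defs
open import Level using (Level; _⊔_)
open import Data.Nat using (ℕ; zero; suc; pred; _≤_; _<_; _≤?_; s≤s; z≤n; ⌈_/2⌉)
import Data.Nat.Properties as ℕ
open import Data.Fin as Fin using (Fin; zero; suc; fromℕ<)
import Data.Fin.Properties as Fin
open import Data.Fin.Properties using (any?)
open import Data.Fin.Subset using (Subset; inside; outside; _∈_; _∉_; _⊆_; _⊂_; ⊥; ⊤; ⁅_⁆; _∪_; _-_; ∣_∣; Nonempty)
open import Data.Fin.Subset.Properties
  using (_∈?_; drop-there; ∈⊤; ∉⊥; ⊥⊆; ⊆-refl; x∈⁅x⁆; x∈⁅y⁆⇒x≡y; x∈p∪q⁻; x∈p∪q⁺; p⊆p∪q; p─q⊆p; p─⊥≡p;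
         p⊂q⇒∣p∣<∣q∣; Empty-unique; ∣⊥∣≡0; ∣⊤∣≡n)
open import Data.Vec using ([]; _∷_; there)
open import Data.Vec.Functional using (Vector; tail; removeAt)
open import Data.Bool using (Bool; true; false; not; T; if_then_else_)
open import Data.Empty using (⊥-elim)
open import Data.Product using (Σ; ∃; _×_; _,_; proj₁; proj₂)
open import Data.Sum using (_⊎_; inj₁; inj₂; [_,_])
open import Data.List using (List; []; _∷_; allFin)
open import Data.List.Membership.Propositional using () renaming (_∈_ to _∈ₗ_)
open import Data.List.Relation.Unary.Any using (here; there)
open import Data.List.Membership.Propositional.Properties using (∈-allFin)
open import Function using (_∘_; id)
open import Function.Bundles using (_⇔_; mk⇔)
open import Relation.Nullary using (¬_; Dec; yes; no; does; ¬?)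
open import Relation.Nullary.Decidable using (decidable-stable; ¬¬-excluded-middle; _×-dec_; does-⇔; ⌊_⌋; isYes≗does; toWitness; fromWitness)
open import Relation.Nullary.Negation using (¬¬-Monad; ¬¬-map; contradiction)
open import Relation.Binary.PropositionalEquality as ≡ using (_≡_; _≢_)
open import Effect.Monad using (RawMonad)

module _ {p : Level} where
  open RawMonad (¬¬-Monad {p})

  ¬¬-∀-Fin : ∀ {n} {P : Fin n → Set p} → (∀ i → ¬ ¬ P i) → ¬ ¬ (∀ i → P i)
  ¬¬-∀-Fin {n = zero}  h = pure λ ()
  ¬¬-∀-Fin {n = suc n} h = do
    p₀ ← h zero
    ps ← ¬¬-∀-Fin (h ∘ suc)
    pure λ where zero → p₀ ; (suc i) → ps i

  ¬¬-∀-Subset : ∀ {n} {P : Subset n → Set p} → (∀ S → ¬ ¬ P S) → ¬ ¬ (∀ S → P S)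
  ¬¬-∀-Subset {n = zero}  h = do
    p₀ ← h []
    pure λ where [] → p₀
  ¬¬-∀-Subset {n = suc n} h = do
    pᵢ ← ¬¬-∀-Subset (h ∘ (inside ∷_))
    pₒ ← ¬¬-∀-Subset (h ∘ (outside ∷_))
    pure λ where (inside ∷ S) → pᵢ S ; (outside ∷ S) → pₒ S

∣p∣≤1+∣p-x∣ : ∀ {n} (p : Subset n) x → ∣ p ∣ ≤ suc ∣ p - x ∣
∣p∣≤1+∣p-x∣ (inside  ∷ p) zero    = s≤s (ℕ.≤-reflexive (≡.cong ∣_∣ (≡.sym (p─⊥≡p p))))
∣p∣≤1+∣p-x∣ (outside ∷ p) zero    = ℕ.m≤n⇒m≤1+n (ℕ.≤-reflexive (≡.cong ∣_∣ (≡.sym (p─⊥≡p p))))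
∣p∣≤1+∣p-x∣ (inside  ∷ p) (suc x) = s≤s (∣p∣≤1+∣p-x∣ p x)
∣p∣≤1+∣p-x∣ (outside ∷ p) (suc x) = ∣p∣≤1+∣p-x∣ p x

x∉p-x : ∀ {n} (p : Subset n) x → x ∉ p - x
x∉p-x (_ ∷ p) zero    ()
x∉p-x (_ ∷ p) (suc x) (there x∈p-x) = x∉p-x p x x∈p-x

∉∪⁅⁆ : ∀ {n} {S : Subset n} {v j} → j ∉ S → j ≢ v → j ∉ S ∪ ⁅ v ⁆
∉∪⁅⁆ {S = S} {v} j∉S j≢v j∈S∪v = [ j∉S , j≢v ∘ x∈⁅y⁆⇒x≡y v ] (x∈p∪q⁻ S ⁅ v ⁆ j∈S∪v)

∪⁅⁆⊆ : ∀ {n} {I A : Subset n} {v} → I ⊆ A → v ∈ A → I ∪ ⁅ v ⁆ ⊆ A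
∪⁅⁆⊆ {I = I} {v = v} I⊆A v∈A j∈I∪v with x∈p∪q⁻ I ⁅ v ⁆ j∈I∪v
... | inj₁ j∈I   = I⊆A j∈I
... | inj₂ j∈⁅v⁆ with x∈⁅y⁆⇒x≡y v j∈⁅v⁆
...   | ≡.refl = v∈A

module _ where
  open import Data.Nat using (_+_; _∸_)

  pred-+-dichotomy : ∀ {a b a′ b′} → 1 ≤ a → 1 ≤ b → a ≤ a′ → b ≤ b′ →
                     pred a + pred b < pred a′ + pred b′ ⊎ (a ≡ a′ × b ≡ b′)
  pred-+-dichotomy (s≤s _) (s≤s _) (s≤s a≤a′) (s≤s b≤b′)
    with ℕ.m≤n⇒m<n∨m≡n a≤a′ | ℕ.m≤n⇒m<n∨m≡n b≤b′
  ... | inj₁ a<a′    | _            = inj₁ (ℕ.+-mono-<-≤ a<a′ b≤b′)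
  ... | inj₂ ≡.refl | inj₁ b<b′    = inj₁ (ℕ.+-mono-≤-< ℕ.≤-refl b<b′)
  ... | inj₂ ≡.refl | inj₂ ≡.refl = inj₂ (≡.refl , ≡.refl)

  pred<⇒≤∸2 : ∀ {a d} → a < d → pred a ≤ d ∸ 2
  pred<⇒≤∸2 {zero}  _                = z≤n
  pred<⇒≤∸2 {suc a} (s≤s (s≤s a≤d)) = a≤d

  ⌈t/2⌉+1≤ : ∀ {t s₀ d} → 2 ≤ d → t ≤ s₀ + 2 → s₀ ≤ (d ∸ 2) + (d ∸ 2) → ⌈ t /2⌉ + 1 ≤ d
  ⌈t/2⌉+1≤ {t} {s₀} {suc (suc e)} (s≤s (s≤s _)) t≤s₀+2 s₀≤e+e = begin
    ⌈ t /2⌉ + 1            ≡⟨ ℕ.+-comm ⌈ t /2⌉ 1 ⟩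
    suc ⌈ t /2⌉            ≤⟨ s≤s (ℕ.⌈n/2⌉-mono (ℕ.≤-trans t≤s₀+2 (ℕ.+-monoˡ-≤ 2 s₀≤e+e))) ⟩
    suc ⌈ e + e + 2 /2⌉    ≡⟨ ≡.cong (λ m → suc ⌈ m /2⌉) (ℕ.+-comm (e + e) 2) ⟩
    suc (suc ⌈ e + e /2⌉)  ≡⟨ ≡.cong (λ m → suc (suc m)) (ℕ.n≡⌈n+n/2⌉ e) ⟨
    suc (suc e)            ∎
    where open ℕ.≤-Reasoning

⌊⌋-⇔ : ∀ {a b} {A : Set a} {B : Set b} → A ⇔ B → (a? : Dec A) (b? : Dec B) → ⌊ a? ⌋ ≡ ⌊ b? ⌋
⌊⌋-⇔ A⇔B a? b? = ≡.trans (isYes≗does a?) (≡.trans (does-⇔ A⇔B a? b?) (≡.sym (isYes≗does b?)))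

leftFirst : ∀ {n} → (Fin n → Bool) → (Fin n → Bool) → Bool
leftFirst {zero}  p q = true
leftFirst {suc n} p q = if p zero then true else if q zero then false else leftFirst (p ∘ suc) (q ∘ suc)

leftFirst-swap : ∀ {n} (p q : Fin n → Bool) → (∀ i → T (p i) → ¬ T (q i)) →
                 ∃ (T ∘ p) → leftFirst q p ≡ not (leftFirst p q)
leftFirst-swap p q disj (zero , p₀) with p zero | q zero | disj zero | p₀
... | true  | true  | d | _ = ⊥-elim (d _ _)
... | true  | false | _ | _ = ≡.refl
... | false | _     | _ | ()
leftFirst-swap p q disj (suc i , pᵢ) with p zero | q zero | disj zero
... | true  | true  | d = ⊥-elim (d _ _)
... | true  | false | _ = ≡.refl
... | false | true  | _ = ≡.refl
... | false | false | _ = leftFirst-swap (p ∘ suc) (q ∘ suc) (disj ∘ suc) (i , pᵢ)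

leftFirst-cong : ∀ {n} {p p′ q q′ : Fin n → Bool} → (∀ i → p i ≡ p′ i) → (∀ i → q i ≡ q′ i) →
                 leftFirst p q ≡ leftFirst p′ q′
leftFirst-cong {zero}  _  _  = ≡.refl
leftFirst-cong {suc n} ep eq rewrite ep zero | eq zero | leftFirst-cong (ep ∘ suc) (eq ∘ suc) = ≡.refl

module LinearAlgebra {c ℓ : Level} (F : Field c ℓ) where
  open Field F hiding (zero; _-_)
  open LinAlg F using (sumF; ⟪_,_⟫; InSpan)
  open import Algebra.Properties.Semiring.Sum semiring
    using (sum; sum-cong-≋; sum-replicate-zero; sum-remove; ∑-distrib-+; ∑-comm; *-distribˡ-sum; *-distribʳ-sum)
  open import Algebra.Properties.CommutativeSemigroup *-commutativeSemigroup using (x∙yz≈y∙xz)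
  open import Algebra.Properties.Ring ring using (-‿distribˡ-*)
  open import Data.Vec.Functional.Relation.Binary.Equality.Setoid setoid using (_≋_)
  open import Relation.Binary.Reasoning.Setoid setoid

  V : ℕ → Set c
  V = Vector Carrier

  0ᵛ : ∀ {n} → V n
  0ᵛ _ = 0#

  infixl 6 _+ᵛ_
  infixr 7 _·_

  _+ᵛ_ : ∀ {n} → V n → V n → V n
  (u +ᵛ v) i = u i + v i

  _·_ : ∀ {n} → Carrier → V n → V n
  (r · v) i = r * v i

  sumF≡sum : ∀ {n} (f : V n) → sumF f ≡ sum f
  sumF≡sum {zero}  f = ≡.refl
  sumF≡sum {suc n} f = ≡.cong (f zero +_) (sumF≡sum (f ∘ suc))

  sum-zero : ∀ {n} {f : V n} → f ≋ 0ᵛ → sum f ≈ 0#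
  sum-zero {n} f≋0 = trans (sum-cong-≋ f≋0) (sum-replicate-zero n)

  δ : ∀ {m} → Fin m → V m
  δ v j = if does (j Fin.≟ v) then 1# else 0#

  δ-diag : ∀ {m} (v : Fin m) → δ v v ≈ 1#
  δ-diag v with v Fin.≟ v
  ... | yes _   = refl
  ... | no v≢v = contradiction ≡.refl v≢v

  δ-offdiag : ∀ {m} {v j : Fin m} → j ≢ v → δ v j ≈ 0#
  δ-offdiag {v = v} {j} j≢v with j Fin.≟ v
  ... | yes j≡v = contradiction j≡v j≢v
  ... | no _    = refl

  lincomb : ∀ {m s} → V m → (Fin m → V s) → V s
  lincomb a w i = sum λ j → a j * w j i

  lincomb-δ : ∀ {m s} (v : Fin m) (w : Fin m → V s) → lincomb (δ v) w ≋ w v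
  lincomb-δ {suc m} v w i = begin
    sum t                          ≈⟨ sum-remove t ⟩
    t v + sum (removeAt t v)       ≈⟨ +-cong (*-congʳ (δ-diag v)) (sum-zero λ j →
                                        trans (*-congʳ (δ-offdiag (Fin.punchInᵢ≢i v j))) (zeroˡ _)) ⟩
    1# * w v i + 0#                ≈⟨ trans (+-identityʳ _) (*-identityˡ _) ⟩
    w v i                          ∎
    where
    t : V (suc m)
    t j = δ v j * w j i

  module _ {m s : ℕ} where

    lincomb-+ : ∀ (a b : V m) (w : Fin m → V s) → lincomb (a +ᵛ b) w ≋ lincomb a w +ᵛ lincomb b w
    lincomb-+ a b w i = trans (sum-cong-≋ λ j → distribʳ (w j i) (a j) (b j))
      (∑-distrib-+ (λ j → a j * w j i) (λ j → b j * w j i))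

    lincomb-· : ∀ r (a : V m) (w : Fin m → V s) → lincomb (r · a) w ≋ r · lincomb a w
    lincomb-· r a w i = trans (sum-cong-≋ λ j → *-assoc r (a j) (w j i))
      (sym (*-distribˡ-sum r (λ j → a j * w j i)))

    lincomb-+δ : ∀ (e : V m) r v (w : Fin m → V s) → lincomb (e +ᵛ r · δ v) w ≋ lincomb e w +ᵛ r · w v
    lincomb-+δ e r v w i = trans (lincomb-+ e (r · δ v) w i)
      (+-congˡ (trans (lincomb-· r (δ v) w i) (*-congˡ (lincomb-δ v w i))))

    lincomb-+ˡ : ∀ (e : V m) (x y : Fin m → V s) → lincomb e (λ j → x j +ᵛ y j) ≋ lincomb e x +ᵛ lincomb e y
    lincomb-+ˡ e x y i = trans (sum-cong-≋ λ j → distribˡ (e j) (x j i) (y j i))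
      (∑-distrib-+ (λ j → e j * x j i) (λ j → e j * y j i))

    lincomb-·ˡ : ∀ (e c : V m) (v : V s) → lincomb e (λ j → c j · v) ≋ (sum λ j → e j * c j) · v
    lincomb-·ˡ e c v i = trans (sum-cong-≋ λ j → sym (*-assoc (e j) (c j) (v i)))
      (sym (*-distribʳ-sum (v i) (λ j → e j * c j)))

  lincomb-assoc : ∀ {k m s} (a : V k) (b : Fin k → V m) (w : Fin m → V s) →
                  lincomb a (λ l → lincomb (b l) w) ≋ lincomb (λ j → sum λ l → a l * b l j) w
  lincomb-assoc a b w i = begin
    (sum λ l → a l * sum λ j → b l j * w j i)   ≈⟨ sum-cong-≋ (λ l → *-distribˡ-sum (a l) (λ j → b l j * w j i)) ⟩
    (sum λ l → sum λ j → a l * (b l j * w j i)) ≈⟨ ∑-comm (λ l j → a l * (b l j * w j i)) ⟩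
    (sum λ j → sum λ l → a l * (b l j * w j i)) ≈⟨ sum-cong-≋ (λ j → sum-cong-≋ λ l → sym (*-assoc (a l) (b l j) (w j i))) ⟩
    (sum λ j → sum λ l → (a l * b l j) * w j i) ≈⟨ sum-cong-≋ (λ j → sym (*-distribʳ-sum (w j i) (λ l → a l * b l j))) ⟩
    (sum λ j → (sum λ l → a l * b l j) * w j i) ∎

  ⟪⟫≡sum : ∀ {s} (x y : V s) → ⟪ x , y ⟫ ≡ sum λ i → x i * y i
  ⟪⟫≡sum x y = sumF≡sum (λ i → x i * y i)

  ⟪⟫-congʳ : ∀ {s} (z : V s) {y y′ : V s} → y ≋ y′ → ⟪ z , y ⟫ ≈ ⟪ z , y′ ⟫
  ⟪⟫-congʳ z {y} {y′} y≋y′ = begin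
    ⟪ z , y ⟫                 ≡⟨ ⟪⟫≡sum z y ⟩
    (sum λ i → z i * y i)    ≈⟨ sum-cong-≋ (λ i → *-congˡ (y≋y′ i)) ⟩
    (sum λ i → z i * y′ i)   ≡⟨ ⟪⟫≡sum z y′ ⟨
    ⟪ z , y′ ⟫                ∎

  ⟪⟫-comm : ∀ {s} (x y : V s) → ⟪ x , y ⟫ ≈ ⟪ y , x ⟫
  ⟪⟫-comm x y = begin
    ⟪ x , y ⟫                ≡⟨ ⟪⟫≡sum x y ⟩
    (sum λ i → x i * y i)   ≈⟨ sum-cong-≋ (λ i → *-comm (x i) (y i)) ⟩
    (sum λ i → y i * x i)   ≡⟨ ⟪⟫≡sum y x ⟨
    ⟪ y , x ⟫                ∎

  ⟪⟫-lincomb : ∀ {m s} (z : V s) (a : V m) (x : Fin m → V s) →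
               ⟪ z , lincomb a x ⟫ ≈ sum λ j → a j * ⟪ z , x j ⟫
  ⟪⟫-lincomb z a x = begin
    ⟪ z , lincomb a x ⟫                          ≡⟨ ⟪⟫≡sum z _ ⟩
    (sum λ i → z i * sum λ j → a j * x j i)     ≈⟨ sum-cong-≋ (λ i → *-distribˡ-sum (z i) (λ j → a j * x j i)) ⟩
    (sum λ i → sum λ j → z i * (a j * x j i))   ≈⟨ ∑-comm (λ i j → z i * (a j * x j i)) ⟩
    (sum λ j → sum λ i → z i * (a j * x j i))   ≈⟨ sum-cong-≋ (λ j → sum-cong-≋ λ i → x∙yz≈y∙xz (z i) (a j) (x j i)) ⟩
    (sum λ j → sum λ i → a j * (z i * x j i))   ≈⟨ sum-cong-≋ (λ j → sym (*-distribˡ-sum (a j) (λ i → z i * x j i))) ⟩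
    (sum λ j → a j * sum λ i → z i * x j i)     ≈⟨ sum-cong-≋ (λ j → *-congˡ (reflexive (≡.sym (⟪⟫≡sum z (x j))))) ⟩
    (sum λ j → a j * ⟪ z , x j ⟫)               ∎

  Supported : ∀ {m} → Subset m → V m → Set ℓ
  Supported M a = ∀ {j} → j ∉ M → a j ≈ 0#

  InSpanOn : ∀ {m s} → (Fin m → V s) → Subset m → V s → Set (c ⊔ ℓ)
  InSpanOn {m} w M y = Σ (V m) λ a → Supported M a × y ≋ lincomb a w

  AllInSpanOn : ∀ {m k s} → (Fin m → V s) → Subset m → (Fin k → V s) → Subset k → Set (c ⊔ ℓ)
  AllInSpanOn w M x S = ∀ {j} → j ∈ S → InSpanOn w M (x j)

  Expresses : ∀ {m k s} → (Fin k → V m) → (Fin k → V s) → Subset k → (Fin m → V s) → Subset m → Set ℓ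
  Expresses a x S w M = ∀ {j} → j ∈ S → Supported M (a j) × x j ≋ lincomb (a j) w

  -- Equality in F is not decidable, so "e j is zero" is only asserted up to double negation.
  Independent : ∀ {k s} → (Fin k → V s) → Subset k → Set (c ⊔ ℓ)
  Independent x S = ∀ e → Supported S e → lincomb e x ≋ 0ᵛ → ∀ j → ¬ ¬ (e j ≈ 0#)

  supported-* : ∀ {m} {M : Subset m} {a t : V m} → Supported M a → (∀ {j} → j ∈ M → t j ≈ 0#) →
                ∀ j → a j * t j ≈ 0#
  supported-* {M = M} supp t≈0 j with j ∈? M
  ... | yes j∈M = trans (*-congˡ (t≈0 j∈M)) (zeroʳ _)
  ... | no  j∉M = trans (*-congʳ (supp j∉M)) (zeroˡ _)

  module _ {m s : ℕ} {w : Fin m → V s} where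

    InSpan⇒InSpanOn-⊤ : ∀ {y} → InSpan w y → InSpanOn w ⊤ y
    InSpan⇒InSpanOn-⊤ (a , y≋) =
      a , (λ j∉⊤ → contradiction ∈⊤ j∉⊤) , λ i → trans (y≋ i) (reflexive (sumF≡sum (λ j → a j * w j i)))

    InSpanOn-mono : ∀ {M M′ y} → M ⊆ M′ → InSpanOn w M y → InSpanOn w M′ y
    InSpanOn-mono M⊆M′ (a , supp , y≋) = a , (λ j∉M′ → supp (j∉M′ ∘ M⊆M′)) , y≋

    InSpanOn-member : ∀ {M v} → v ∈ M → InSpanOn w M (w v)
    InSpanOn-member {v = v} v∈M =
      δ v , (λ {j} j∉M → δ-offdiag {v = v} {j} λ { ≡.refl → j∉M v∈M }) , λ i → sym (lincomb-δ v w i)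

    choose-coefficients : ∀ {k M} {x : Fin k → V s} {S} → AllInSpanOn w M x S → ∃ λ a → Expresses a x S w M
    choose-coefficients {M = M} {x} {S} xs = a , a-expresses
      where
      a : Fin _ → V m
      a j with j ∈? S
      ... | yes j∈S = proj₁ (xs j∈S)
      ... | no  _   = 0ᵛ
      a-expresses : Expresses a x S w M
      a-expresses {j} j∈S with j ∈? S
      ... | yes j∈S′ = proj₂ (xs j∈S′)
      ... | no  j∉S  = contradiction j∈S j∉S

  lincomb-cong-on : ∀ {m s} {M : Subset m} {a : V m} {x x′ : Fin m → V s} →
                    Supported M a → (∀ {j} → j ∈ M → x j ≋ x′ j) → lincomb a x ≋ lincomb a x′
  lincomb-cong-on {M = M} {a} {x} {x′} supp x≋x′ i = sum-cong-≋ term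
    where
    term : ∀ j → a j * x j i ≈ a j * x′ j i
    term j with j ∈? M
    ... | yes j∈M = *-congˡ (x≋x′ j∈M i)
    ... | no  j∉M = trans (vanish (x j i)) (sym (vanish (x′ j i)))
      where
      vanish : ∀ t → a j * t ≈ 0#
      vanish t = trans (*-congʳ (supp j∉M)) (zeroˡ t)

  InSpanOn-trans : ∀ {k m s} {w : Fin m → V s} {N} {x : Fin k → V s} {M y} →
                   AllInSpanOn w N x M → InSpanOn x M y → InSpanOn w N y
  InSpanOn-trans {w = w} {N} {x} {M} xs (a , supp , y≋) with choose-coefficients xs
  ... | b , b-expresses =
    (λ j → sum λ l → a l * b l j) ,
    (λ {j} j∉N → sum-zero (supported-* {t = λ l → b l j} supp λ l∈M → proj₁ (b-expresses l∈M) j∉N)) ,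
    λ i → trans (y≋ i) (trans (lincomb-cong-on supp (λ l∈M → proj₂ (b-expresses l∈M)) i) (lincomb-assoc a b w i))

  ⟪⟫-InSpanOn : ∀ {m s} {x : Fin m → V s} {M} (z : V s) {y} →
                (∀ {j} → j ∈ M → ⟪ z , x j ⟫ ≈ 0#) → InSpanOn x M y → ⟪ z , y ⟫ ≈ 0#
  ⟪⟫-InSpanOn {x = x} z z⊥xs (a , supp , y≋) =
    trans (⟪⟫-congʳ z y≋) (trans (⟪⟫-lincomb z a x) (sum-zero (supported-* {t = λ j → ⟪ z , x j ⟫} supp z⊥xs)))

  InSpanOn-tail : ∀ {m s} {w : Fin (suc m) → V s} {b M} {a : V (suc m)} {y} →
                  Supported (b ∷ M) a → a zero ≈ 0# → y ≋ lincomb a w → InSpanOn (tail w) M y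
  InSpanOn-tail {a = a} supp a₀≈0 y≋ =
    tail a , (λ j∉M → supp (j∉M ∘ drop-there)) ,
    λ i → trans (y≋ i) (trans (+-congʳ (trans (*-congʳ a₀≈0) (zeroˡ _))) (+-identityˡ _))

  Supported-∪⁅⁆ : ∀ {m} {S : Subset m} {v} {e : V m} → Supported (S ∪ ⁅ v ⁆) e → e v ≈ 0# → Supported S e
  Supported-∪⁅⁆ {v = v} supp ev≈0 {j} j∉S with j Fin.≟ v
  ... | yes ≡.refl = ev≈0
  ... | no  j≢v    = supp (∉∪⁅⁆ j∉S j≢v)

  module _ {k s : ℕ} {x : Fin k → V s} where

    Independent-⊥ : Independent x ⊥
    Independent-⊥ e supp _ j ej≉0 = ej≉0 (supp ∉⊥)

    Independent⇒nonzero : ∀ {S j} → Independent x S → j ∈ S → ¬ x j ≋ 0ᵛ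
    Independent⇒nonzero {j = j} ind j∈S xj≋0 =
      ind (δ j) (λ {l} l∉S → δ-offdiag {v = j} {l} λ { ≡.refl → l∉S j∈S })
          (λ i → trans (lincomb-δ j x i) (xj≋0 i)) j
          (λ δjj≈0 → 1≉0 (trans (sym (δ-diag j)) δjj≈0))

    Independent-∪ : ∀ {S v} → Independent x S → ¬ InSpanOn x S (x v) → Independent x (S ∪ ⁅ v ⁆)
    Independent-∪ {S} {v} ind xv∉span e supp e≋0 j ej≉0 = ¬¬-excluded-middle λ where
        (yes ev≈0) → ind e (Supported-∪⁅⁆ supp ev≈0) e≋0 j ej≉0
        (no  ev≉0) → xv∉span (solve-for-xv (inverse (e v) ev≉0))
      where
      solve-for-xv : Σ Carrier (λ β → e v * β ≈ 1#) → InSpanOn x S (x v)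
      solve-for-xv (β , evβ≈1) = δ v +ᵛ (- β) · e , supported , λ i → sym (begin
          lincomb (δ v +ᵛ (- β) · e) x i             ≈⟨ lincomb-+ (δ v) ((- β) · e) x i ⟩
          lincomb (δ v) x i + lincomb ((- β) · e) x i ≈⟨ +-cong (lincomb-δ v x i) (lincomb-· (- β) e x i) ⟩
          x v i + (- β) * lincomb e x i               ≈⟨ +-congˡ (trans (*-congˡ (e≋0 i)) (zeroʳ _)) ⟩
          x v i + 0#                                  ≈⟨ +-identityʳ _ ⟩
          x v i                                       ∎)
        where
        supported : Supported S (δ v +ᵛ (- β) · e)
        supported {j} j∉S with j Fin.≟ v
        ... | yes ≡.refl = begin
          1# + (- β) * e v      ≈⟨ +-congˡ (sym (-‿distribˡ-* β (e v))) ⟩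
          1# + - (β * e v)      ≈⟨ +-congˡ (-‿cong (trans (*-comm β (e v)) evβ≈1)) ⟩
          1# + - 1#             ≈⟨ -‿inverseʳ 1# ⟩
          0#                    ∎
        ... | no j≢v = begin
          0# + (- β) * e j      ≈⟨ +-congˡ (*-congˡ (supp (∉∪⁅⁆ j∉S j≢v))) ⟩
          0# + (- β) * 0#       ≈⟨ trans (+-identityˡ _) (zeroʳ _) ⟩
          0#                    ∎

    Independent-shear : ∀ {S i₀} → Independent x S → i₀ ∈ S → (c : V k) →
                        Independent (λ j → x j +ᵛ c j · x i₀) (S - i₀)
    Independent-shear {S} {i₀} ind i₀∈S c e supp e≋0 j with j Fin.≟ i₀
    ... | yes ≡.refl = λ ej≉0 → ej≉0 (supp (x∉p-x S i₀))
    ... | no  j≢i₀   = ¬¬-map (λ e′j≈0 → trans (sym (e′≈e j≢i₀)) e′j≈0) (ind e′ supported combination j)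
      where
      K : Carrier
      K = sum λ l → e l * c l
      e′ : V k
      e′ = e +ᵛ K · δ i₀
      e′≈e : ∀ {l} → l ≢ i₀ → e′ l ≈ e l
      e′≈e l≢i₀ = trans (+-congˡ (trans (*-congˡ (δ-offdiag l≢i₀)) (zeroʳ K))) (+-identityʳ _)
      supported : Supported S e′
      supported {l} l∉S = trans (e′≈e λ { ≡.refl → l∉S i₀∈S }) (supp (l∉S ∘ p─q⊆p S ⁅ i₀ ⁆))
      combination : lincomb e′ x ≋ 0ᵛ
      combination i = begin
        lincomb e′ x i                                   ≈⟨ lincomb-+δ e K i₀ x i ⟩
        lincomb e x i + K * x i₀ i                       ≈⟨ +-congˡ (lincomb-·ˡ e c (x i₀) i) ⟨
        lincomb e x i + lincomb e (λ l → c l · x i₀) i   ≈⟨ lincomb-+ˡ e x (λ l → c l · x i₀) i ⟨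
        lincomb e (λ l → x l +ᵛ c l · x i₀) i           ≈⟨ e≋0 i ⟩
        0#                                               ∎

  pivot-cancel : ∀ {α β} → α * β ≈ 1# → ∀ a → a + (- (a * β)) * α ≈ 0#
  pivot-cancel {α} {β} αβ≈1 a = begin
    a + (- (a * β)) * α  ≈⟨ +-congˡ (-‿distribˡ-* (a * β) α) ⟨
    a + - ((a * β) * α)  ≈⟨ +-congˡ (-‿cong (trans (*-assoc a β α) (trans (*-congˡ (trans (*-comm β α) αβ≈1)) (*-identityʳ a)))) ⟩
    a + - a              ≈⟨ -‿inverseʳ a ⟩
    0#                   ∎

  -- Gaussian elimination of w zero against the pivot x i₀: y j = x j - (a j zero / a i₀ zero) · x i₀.
  exchange : ∀ {m k s} {w : Fin (suc m) → V s} {b M} {x : Fin k → V s} {S a i₀} →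
             Independent x S → Expresses a x S w (b ∷ M) → i₀ ∈ S → ¬ (a i₀ zero ≈ 0#) →
             ∃ λ y → Independent y (S - i₀) × AllInSpanOn (tail w) M y (S - i₀)
  exchange {m} {k} {s} {w} {b} {M} {x} {S} {a} {i₀} ind a-expresses i₀∈S α≉0 with inverse (a i₀ zero) α≉0
  ... | β , αβ≈1 = y , Independent-shear ind i₀∈S γ , y-spanned
    where
    γ : V k
    γ j = - (a j zero * β)
    y : Fin k → V s
    y j = x j +ᵛ γ j · x i₀
    y-spanned : AllInSpanOn (tail w) M y (S - i₀)
    y-spanned {j} j∈S-i₀ = InSpanOn-tail {w = w} supported (pivot-cancel αβ≈1 (a j zero)) expressed
      where
      j∈S : j ∈ S
      j∈S = p─q⊆p S ⁅ i₀ ⁆ j∈S-i₀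
      a′ : V (suc m)
      a′ = a j +ᵛ γ j · a i₀
      supported : Supported (b ∷ M) a′
      supported l∉ = trans (+-cong (proj₁ (a-expresses j∈S) l∉) (*-congˡ (proj₁ (a-expresses i₀∈S) l∉)))
                           (trans (+-identityˡ _) (zeroʳ _))
      expressed : y j ≋ lincomb a′ w
      expressed i = begin
        x j i + γ j * x i₀ i                          ≈⟨ +-cong (proj₂ (a-expresses j∈S) i) (*-congˡ (proj₂ (a-expresses i₀∈S) i)) ⟩
        lincomb (a j) w i + γ j * lincomb (a i₀) w i  ≈⟨ +-congˡ (lincomb-· (γ j) (a i₀) w i) ⟨
        lincomb (a j) w i + lincomb (γ j · a i₀) w i  ≈⟨ lincomb-+ (a j) (γ j · a i₀) w i ⟨
        lincomb a′ w i                                ∎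

  steinitz : ∀ {m k s} (w : Fin m → V s) (M : Subset m) (x : Fin k → V s) (S : Subset k) →
             Independent x S → AllInSpanOn w M x S → ∣ S ∣ ≤ ∣ M ∣
  steinitz {k = k} w [] x S ind xs = ℕ.≤-reflexive (≡.trans (≡.cong ∣_∣ (Empty-unique S-empty)) (∣⊥∣≡0 k))
    where
    S-empty : ¬ Nonempty S
    S-empty (j , j∈S) = Independent⇒nonzero ind j∈S (proj₂ (proj₂ (xs j∈S)))
  steinitz w (outside ∷ M) x S ind xs = steinitz (tail w) M x S ind λ j∈S →
    let (a , supp , x≋) = xs j∈S in InSpanOn-tail {w = w} supp (supp λ ()) x≋
  steinitz {suc m} {k} w (inside ∷ M) x S ind xs =
    decidable-stable (∣ S ∣ ≤? suc ∣ M ∣) (¬¬-map pivot-or-not (¬¬-∀-Fin λ _ → ¬¬-excluded-middle))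
    where
    a : Fin k → V (suc m)
    a = proj₁ (choose-coefficients {w = w} xs)
    a-expresses : Expresses a x S w (inside ∷ M)
    a-expresses = proj₂ (choose-coefficients {w = w} xs)
    pivot-or-not : (∀ j → Dec (a j zero ≈ 0#)) → ∣ S ∣ ≤ suc ∣ M ∣
    pivot-or-not a?₀ with any? (λ j → j ∈? S ×-dec ¬? (a?₀ j))
    ... | yes (i₀ , i₀∈S , α≉0) =
      let (y , y-independent , ys) = exchange {w = w} ind a-expresses i₀∈S α≉0 in
      ℕ.≤-trans (∣p∣≤1+∣p-x∣ S i₀) (s≤s (steinitz (tail w) M y (S - i₀) y-independent ys))
    ... | no ∄pivot = ℕ.m≤n⇒m≤1+n (steinitz (tail w) M x S ind λ j∈S →
      InSpanOn-tail {w = w} (proj₁ (a-expresses j∈S)) (no-pivot j∈S) (proj₂ (a-expresses j∈S)))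
      where
      no-pivot : ∀ {j} → j ∈ S → a j zero ≈ 0#
      no-pivot {j} j∈S with a?₀ j
      ... | yes a₀≈0 = a₀≈0
      ... | no  a₀≉0 = contradiction (j , j∈S , a₀≉0) ∄pivot

  steinitz-∪ : ∀ {m k s} {w : Fin m → V s} {M} {x : Fin k → V s} {I z} →
               Independent x I → ¬ InSpanOn x I (x z) →
               AllInSpanOn w M x I → InSpanOn w M (x z) → ∣ I ∣ < ∣ M ∣
  steinitz-∪ {w = w} {M} {x} {I} {z} ind xz∉span xs xz =
    ℕ.<-≤-trans (p⊂q⇒∣p∣<∣q∣ I⊂I∪z) (steinitz w M x (I ∪ ⁅ z ⁆) (Independent-∪ ind xz∉span) xs′)
    where
    I⊂I∪z : I ⊂ I ∪ ⁅ z ⁆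
    I⊂I∪z = p⊆p∪q ⁅ z ⁆ , z , x∈p∪q⁺ (inj₂ (x∈⁅x⁆ z)) , xz∉span ∘ InSpanOn-member
    xs′ : AllInSpanOn w M x (I ∪ ⁅ z ⁆)
    xs′ j∈I∪z with x∈p∪q⁻ I ⁅ z ⁆ j∈I∪z
    ... | inj₁ j∈I   = xs j∈I
    ... | inj₂ j∈⁅z⁆ with x∈⁅y⁆⇒x≡y z j∈⁅z⁆
    ...   | ≡.refl = xz

  SpanDecider : ∀ {k s} → (Fin k → V s) → Set (c ⊔ ℓ)
  SpanDecider x = ∀ T v → Dec (InSpanOn x T (x v))

  module Rank {k s} (x : Fin k → V s) (span? : SpanDecider x) where

    record Basis (A : Subset k) : Set (c ⊔ ℓ) where
      field
        elements    : Subset k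
        elements⊆A  : elements ⊆ A
        independent : Independent x elements
        spanning    : AllInSpanOn x elements x A

    open Basis

    private
      Pending : Subset k → List (Fin k) → Subset k → Set (c ⊔ ℓ)
      Pending A vs I = ∀ {u} → u ∈ A → u ∈ₗ vs ⊎ InSpanOn x I (x u)

      advance : ∀ {A v vs I J} → I ⊆ J → (v ∈ A → InSpanOn x J (x v)) → Pending A (v ∷ vs) I → Pending A vs J
      advance I⊆J covered pending u∈A with pending u∈A
      ... | inj₁ (here ≡.refl) = inj₂ (covered u∈A)
      ... | inj₁ (there u∈vs)  = inj₁ u∈vs
      ... | inj₂ xu∈span       = inj₂ (InSpanOn-mono I⊆J xu∈span)

    greedy : ∀ {A} (vs : List (Fin k)) (I : Subset k) → I ⊆ A → Independent x I → Pending A vs I → Basis A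
    greedy [] I I⊆A ind pending = record
      { elements = I ; elements⊆A = I⊆A ; independent = ind
      ; spanning = λ v∈A → [ (λ ()) , id ] (pending v∈A) }
    greedy {A} (v ∷ vs) I I⊆A ind pending with span? I v | v ∈? A
    ... | yes xv∈span | _       = greedy vs I I⊆A ind (advance ⊆-refl (λ _ → xv∈span) pending)
    ... | no _        | no v∉A = greedy vs I I⊆A ind (advance ⊆-refl (λ v∈A → contradiction v∈A v∉A) pending)
    ... | no xv∉span  | yes v∈A =
      greedy vs (I ∪ ⁅ v ⁆) (∪⁅⁆⊆ I⊆A v∈A) (Independent-∪ ind xv∉span)
        (advance (p⊆p∪q ⁅ v ⁆) (λ _ → InSpanOn-member (x∈p∪q⁺ (inj₂ (x∈⁅x⁆ v)))) pending)

    basis : ∀ A → Basis A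
    basis A = greedy (allFin k) ⊥ ⊥⊆ Independent-⊥ λ {v} _ → inj₁ (∈-allFin v)

    rank : Subset k → ℕ
    rank A = ∣ elements (basis A) ∣

    rank-mono : ∀ {A A′} → A ⊆ A′ → rank A ≤ rank A′
    rank-mono {A} {A′} A⊆A′ = steinitz x (elements (basis A′)) x (elements (basis A))
      (independent (basis A)) λ j∈ → spanning (basis A′) (A⊆A′ (elements⊆A (basis A) j∈))

    rank-< : ∀ {m} {w : Fin m → V s} {M A z} →
             ¬ InSpanOn x A (x z) → AllInSpanOn w M x A → InSpanOn w M (x z) → rank A < ∣ M ∣
    rank-< {A = A} xz∉span xs xz = steinitz-∪ (independent (basis A))
      (xz∉span ∘ InSpanOn-mono (elements⊆A (basis A))) (λ j∈ → xs (elements⊆A (basis A) j∈)) xz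

    rank-pos : ∀ {A a} → a ∈ A → ¬ InSpanOn x ⊥ (x a) → 1 ≤ rank A
    rank-pos {A} a∈A xa∉span = ≡.subst (_< rank A) (∣⊥∣≡0 k)
      (steinitz-∪ Independent-⊥ xa∉span (λ j∈⊥ → contradiction j∈⊥ ∉⊥) (spanning (basis A) a∈A))

    rank-≡⇒InSpanOn : ∀ {A A′} → A ⊆ A′ → rank A ≡ rank A′ → ∀ {y} → InSpanOn x A′ y → InSpanOn x A y
    rank-≡⇒InSpanOn {A} {A′} A⊆A′ rankA≡rankA′ y∈span =
      InSpanOn-mono (elements⊆A (basis A)) (InSpanOn-trans covered y∈span)
      where
      covered : AllInSpanOn x (elements (basis A)) x A′
      covered {v} v∈A′ with span? (elements (basis A)) v
      ... | yes xv∈span = xv∈span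
      ... | no  xv∉span = contradiction rankA≡rankA′ (ℕ.<⇒≢ (steinitz-∪ (independent (basis A)) xv∉span
              (λ j∈ → spanning (basis A′) (A⊆A′ (elements⊆A (basis A) j∈))) (spanning (basis A′) v∈A′)))

module OrthogonalRepresentation {c ℓ : Level} (F : Field c ℓ) (G : Graph) {s : ℕ} (ρ : LinAlg.OrthRep F G s) where
  open Field F using (_≈_; trans; 0#)
  open LinAlg F using (⟪_,_⟫; Locality≤; module OrthRep)
  open LinearAlgebra F
  open Graph G
  open OrthRep ρ

  ∉span-of-common-neighbour : ∀ {X z} → (∀ {j} → j ∈ X → Adj z j) → ¬ InSpanOn u X (u z)
  ∉span-of-common-neighbour {z = z} adj uz∈span =
    nondeg z (⟪⟫-InSpanOn (u z) (λ j∈X → orth z _ (adj j∈X)) uz∈span)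

  biclique-spans-orthogonal : ∀ {A B y y′} → (∀ {a b} → a ∈ A → b ∈ B → Adj a b) →
                              InSpanOn u A y → InSpanOn u B y′ → ⟪ y , y′ ⟫ ≈ 0#
  biclique-spans-orthogonal {y = y} adj y∈span y′∈span = ⟪⟫-InSpanOn y (λ b∈B →
    trans (⟪⟫-comm y (u _)) (⟪⟫-InSpanOn (u _) (λ a∈A → orth _ _ (Adj-sym (adj a∈A b∈B))) y∈span)) y′∈span

  module _ (span? : SpanDecider u) {d : ℕ} (loc : Locality≤ ρ d) where
    open Rank u span?
    open import Data.Nat using (_+_; _∸_)

    rank<d : ∀ {X z} → (∀ {j} → j ∈ X → Adj z j) → rank X < d
    rank<d {X} {z} adj with loc z
    ... | W , nbhd⊆span = ≡.subst (rank X <_) (∣⊤∣≡n d) (rank-< (∉span-of-common-neighbour adj)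
      (λ j∈X → InSpan⇒InSpanOn-⊤ (nbhd⊆span _ (inj₂ (adj j∈X))))
      (InSpan⇒InSpanOn-⊤ (nbhd⊆span z (inj₁ ≡.refl))))

    rank-nonempty : ∀ {A a} → a ∈ A → 1 ≤ rank A
    rank-nonempty a∈A = rank-pos a∈A (∉span-of-common-neighbour λ j∈⊥ → contradiction j∈⊥ ∉⊥)

    2≤d : HasEdge G → 2 ≤ d
    2≤d (a , b , a~b) = ℕ.≤-trans (s≤s (rank-nonempty (x∈⁅x⁆ a))) (rank<d b~⁅a⁆)
      where
      b~⁅a⁆ : ∀ {j} → j ∈ ⁅ a ⁆ → Adj b j
      b~⁅a⁆ j∈⁅a⁆ with x∈⁅y⁆⇒x≡y a j∈⁅a⁆
      ... | ≡.refl = Adj-sym a~b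

    module _ (p : HomK2 G) where
      open HomK2 p

      level : ℕ
      level = pred (rank A) + pred (rank B)

      level< : level < suc ((d ∸ 2) + (d ∸ 2))
      level< = s≤s (ℕ.+-mono-≤ (pred<⇒≤∸2 (rank<d λ a∈A → Adj-sym (compl a∈A (proj₂ B-ne))))
                               (pred<⇒≤∸2 (rank<d λ b∈B → compl (proj₂ A-ne) b∈B)))

      sign : Bool
      sign = leftFirst (λ v → ⌊ span? A v ⌋) (λ v → ⌊ span? B v ⌋)

      index : Q ((d ∸ 2) + (d ∸ 2))
      index = fromℕ< level< , sign

    index-monotone : ∀ {p q} → p ≤H q → index p ≤Q index q
    index-monotone {p} {q} (A⊆A′ , B⊆B′)
      with pred-+-dichotomy (rank-nonempty (proj₂ (HomK2.A-ne p))) (rank-nonempty (proj₂ (HomK2.B-ne p)))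
                            (rank-mono A⊆A′) (rank-mono B⊆B′)
    ... | inj₁ level-p<level-q =
      inj₂ (≡.subst₂ _<_ (≡.sym (Fin.toℕ-fromℕ< (level< p))) (≡.sym (Fin.toℕ-fromℕ< (level< q))) level-p<level-q)
    ... | inj₂ (rankA≡ , rankB≡) =
      inj₁ ( Fin.fromℕ<-cong _ _ (≡.cong₂ (λ a b → pred a + pred b) rankA≡ rankB≡) (level< p) (level< q)
           , leftFirst-cong (same-span A⊆A′ rankA≡) (same-span B⊆B′ rankB≡))
      where
      same-span : ∀ {A A′} → A ⊆ A′ → rank A ≡ rank A′ → ∀ v → ⌊ span? A v ⌋ ≡ ⌊ span? A′ v ⌋
      same-span A⊆A′ rank≡ v =
        ⌊⌋-⇔ (mk⇔ (InSpanOn-mono A⊆A′) (rank-≡⇒InSpanOn A⊆A′ rank≡)) (span? _ v) (span? _ v)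

    index-equivariant : ∀ p → index (swapH p) ≡ negQ (index p)
    index-equivariant p = ≡.cong₂ _,_
      (Fin.fromℕ<-cong _ _ (ℕ.+-comm (pred (rank B)) (pred (rank A))) (level< (swapH p)) (level< p))
      (leftFirst-swap (λ v → ⌊ span? A v ⌋) (λ v → ⌊ span? B v ⌋)
        (λ v v∈spanA v∈spanB → nondeg v (biclique-spans-orthogonal compl (toWitness v∈spanA) (toWitness v∈spanB)))
        (proj₁ A-ne , fromWitness (InSpanOn-member (proj₂ A-ne))))
      where open HomK2 p

    hom-map : Z2Map G ((d ∸ 2) + (d ∸ 2))
    hom-map = record { f = index ; monotone = λ {p} {q} → index-monotone {p} {q} ; equivar = index-equivariant }

open import Data.Nat using (_+_)

theorem1p5 : {c ℓ : Level} (F : Field c ℓ) (G : Graph) (t : ℕ) →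
    HasEdge G → TopChromatic G t →
    LinAlg.LocOrthDim≥ F G (⌈ t /2⌉ + 1)
theorem1p5 F G t edge (s₀ , (_ , minimal) , t≤s₀+2) s ρ d loc =
  decidable-stable (⌈ t /2⌉ + 1 ≤? d) (¬¬-map bound span-oracle)
  where
  open LinearAlgebra F using (SpanDecider)
  open OrthogonalRepresentation F G ρ
  span-oracle : ¬ ¬ SpanDecider (LinAlg.OrthRep.u ρ)
  span-oracle = ¬¬-∀-Subset λ _ → ¬¬-∀-Fin λ _ → ¬¬-excluded-middle
  bound : SpanDecider (LinAlg.OrthRep.u ρ) → ⌈ t /2⌉ + 1 ≤ d
  bound span? = ⌈t/2⌉+1≤ (2≤d span? loc edge) t≤s₀+2 (minimal _ (hom-map span? loc))
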